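{- For every $k \in \mathbb{Z}_{\ge 0}$, we have $\vert S_k\vert < 1 + \frac{4n}{\ell_{k+1}}$. Consequently, $\vert S_{\kappa} \vert = 1$ holds for $\kappa:= 2\lceil\log_{4/3}(4n)\rceil$.
   Context: Let $S\in\Sigma^n$, $\Sigma=[0..\sigma)=\{0,\ldots,\sigma-1\}$. Let $\mathcal{A}$ be the least set with $\mathcal{A}=\Sigma\cup(\mathcal{A}\times\mathbb{Z}_{\ge2})\cup\bigcup_{i\ge2}\mathcal{A}^i$, with expansion $\mathrm{exp}(a)=a$ for $a\in\Sigma$, $\mathrm{exp}((A_1,\ldots,A_i))=\mathrm{exp}(A_1)\cdots\mathrm{exp}(A_i)$, $\mathrm{exp}((B,m))=\mathrm{exp}(B)^m$. Restricted block compression: let $\ell_k=(4/3)^{\lceil k/2\rceil-1}$ and $\mathcal{A}_k=\{A\in\mathcal{A}:|\mathrm{exp}(A)|\le\ell_k\}$. Set $S_0=S$. For odd $k>0$, $S_k$ is obtained from $T=S_{k-1}$ by placing a block boundary between $T[i]$ and $T[i+1]$ whenever $T[i]\notin\mathcal{A}_k$, $T[i+1]\notin\mathcal{A}_k$, or $T[i]\ne T[i+1]$, and replacing each block $A^m$ with $m\ge2$ by the symbol $(A,m)$. For even $k>0$, with $\pi_k$ a bijection from the set of symbols occurring in $S_{k-1}$ to $[1..|\Sigma(S_{k-1})|]$ such that $\pi_k(A)<\pi_k(B)$ whenever $A\notin\mathcal{A}_k$ and $B\in\mathcal{A}_k$, $S_k$ is obtained from $T=S_{k-1}$ by placing a block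 boundary between $T[i]$ and $T[i+1]$ whenever $T[i]\notin\mathcal{A}_k$, $T[i+1]\notin\mathcal{A}_k$, or $i$ is a local minimum ($1<i<|T|$ and $\pi_k(T[i-1])>\pi_k(T[i])<\pi_k(T[i+1])$), and replacing each block $T[i..i+m)$ with $m\ge2$ by the symbol $(T[i],\ldots,T[i+m-1])$. Then $\mathrm{exp}(S_k)=S$ for all $k$. -}

module Defs where

open import Data.Nat using (ℕ; zero; suc; _+_; _*_; _∸_; _^_; _≤_; _<_; _≤?_; ⌈_/2⌉)
open import Data.Fin using (Fin)
import Data.Fin as Fin
open import Data.Bool using (Bool; true; false; not; _∧_; _∨_; if_then_else_)
open import Data.List using (List; []; _∷_; length; concat; replicate; map)
open import Data.List.NonEmpty using (List⁺; _∷_; toList)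
open import Data.List.Membership.Propositional using (_∈_)
open import Data.Maybe using (Maybe; just; nothing)
open import Data.Vec using (Vec)
import Data.Vec as Vec
open import Data.Product using (Σ; _×_; _,_; ∃)
open import Relation.Binary.PropositionalEquality using (_≡_; refl; cong; cong₂)
open import Relation.Nullary using (Dec; yes; no; ¬_)
open import Relation.Nullary.Decidable using (⌊_⌋)

-- Symbols of 𝒜 over the alphabet Σ = [0..σ) (represented by Fin σ).
--   chr a        : a letter a ∈ Σ
--   pw B m       : the run-length symbol (B , m)        (m ≥ 2 when produced)
--   sq (A₁…Aᵢ)   : the block symbol (A₁,…,Aᵢ)           (i ≥ 2 when produced)

data Sym (σ : ℕ) : Set where
  chr : Fin σ → Sym σ
  pw  : Sym σ → ℕ → Sym σ
  sq  : List (Sym σ) → Sym σ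

mutual
  expand : ∀ {σ} → Sym σ → List (Fin σ)
  expand (chr a)  = a ∷ []
  expand (pw B m) = concat (replicate m (expand B))
  expand (sq As)  = expandList As

  expandList : ∀ {σ} → List (Sym σ) → List (Fin σ)
  expandList []       = []
  expandList (A ∷ As) = expand A Data.List.++ expandList As

mutual
  _≟S_ : ∀ {σ} (A B : Sym σ) → Dec (A ≡ B)
  chr a ≟S chr b with a Fin.≟ b
  ... | yes refl = yes refl
  ... | no ne    = no λ { refl → ne refl }
  chr _ ≟S pw _ _ = no λ ()
  chr _ ≟S sq _   = no λ ()
  pw _ _ ≟S chr _ = no λ ()
  pw A m ≟S pw B k with A ≟S B | m Data.Nat.≟ k
  ... | yes refl | yes refl = yes refl
  ... | no ne    | _        = no λ { refl → ne refl }
  ... | yes _    | no ne    = no λ { refl → ne refl }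
  pw _ _ ≟S sq _  = no λ ()
  sq _ ≟S chr _   = no λ ()
  sq _ ≟S pw _ _  = no λ ()
  sq As ≟S sq Bs with As ≟L Bs
  ... | yes refl = yes refl
  ... | no ne    = no λ { refl → ne refl }

  _≟L_ : ∀ {σ} (As Bs : List (Sym σ)) → Dec (As ≡ Bs)
  [] ≟L [] = yes refl
  [] ≟L (_ ∷ _) = no λ ()
  (_ ∷ _) ≟L [] = no λ ()
  (A ∷ As) ≟L (B ∷ Bs) with A ≟S B | As ≟L Bs
  ... | yes refl | yes refl = yes refl
  ... | no ne    | _        = no λ { refl → ne refl }
  ... | yes _    | no ne    = no λ { refl → ne refl }

-- ℓ_k = (4/3)^(⌈k/2⌉-1).  We write ℓ_k = 4^(e k) / 3^(e k) with
-- e k = ⌈k/2⌉ ∸ 1 (all uses have k ≥ 1), and compare by cross-multiplying.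

e : ℕ → ℕ
e k = ⌈ k /2⌉ ∸ 1

In𝒜 : ∀ {σ} → ℕ → Sym σ → Set
In𝒜 k A = length (expand A) * 3 ^ e k ≤ 4 ^ e k

in𝒜? : ∀ {σ} → ℕ → Sym σ → Bool
in𝒜? k A = ⌊ length (expand A) * 3 ^ e k ≤? 4 ^ e k ⌋

-- Splitting a list into blocks, given for each pair of consecutive
-- positions (i, i+1) a Boolean "there is a block boundary here".

consHead : ∀ {A : Set} → A → List (List⁺ A) → List (List⁺ A)
consHead x []             = (x ∷ []) ∷ []
consHead x ((y ∷ ys) ∷ bs) = (x ∷ y ∷ ys) ∷ bs

splitB : ∀ {A : Set} → List A → List Bool → List (List⁺ A)
splitB []           _        = []
splitB (x ∷ [])     _        = (x ∷ []) ∷ []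
splitB (x ∷ y ∷ xs) []       = (x ∷ []) ∷ splitB (y ∷ xs) []
splitB (x ∷ y ∷ xs) (b ∷ bs) =
  if b then (x ∷ []) ∷ splitB (y ∷ xs) bs else consHead x (splitB (y ∷ xs) bs)

boundOdd : ∀ {σ} → ℕ → List (Sym σ) → List Bool
boundOdd k []           = []
boundOdd k (x ∷ [])     = []
boundOdd k (x ∷ y ∷ xs) =
  (not (in𝒜? k x) ∨ not (in𝒜? k y) ∨ not ⌊ x ≟S y ⌋) ∷ boundOdd k (y ∷ xs)

powSym : ∀ {σ} → List⁺ (Sym σ) → Sym σ
powSym (x ∷ [])     = x
powSym (x ∷ y ∷ xs) = pw x (length (x ∷ y ∷ xs))

stepOdd : ∀ {σ} → ℕ → List (Sym σ) → List (Sym σ)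
stepOdd k T = map powSym (splitB T (boundOdd k T))

locMin : ∀ {σ} → (Sym σ → ℕ) → Maybe (Sym σ) → Sym σ → Sym σ → Bool
locMin π nothing  x y = false
locMin π (just w) x y = ⌊ π x Data.Nat.<? π w ⌋ ∧ ⌊ π x Data.Nat.<? π y ⌋

-- the Maybe argument is the symbol preceding x (nothing if x is T[1])
boundEven : ∀ {σ} → ℕ → (Sym σ → ℕ) → Maybe (Sym σ) → List (Sym σ) → List Bool
boundEven k π p []           = []
boundEven k π p (x ∷ [])     = []
boundEven k π p (x ∷ y ∷ xs) =
  (not (in𝒜? k x) ∨ not (in𝒜? k y) ∨ locMin π p x y) ∷ boundEven k π (just x) (y ∷ xs)

blockSym : ∀ {σ} → List⁺ (Sym σ) → Sym σ
blockSym (x ∷ [])     = x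
blockSym (x ∷ y ∷ xs) = sq (x ∷ y ∷ xs)

stepEven : ∀ {σ} → ℕ → (Sym σ → ℕ) → List (Sym σ) → List (Sym σ)
stepEven k π T = map blockSym (splitB T (boundEven k π nothing T))

isOdd : ℕ → Bool
isOdd zero    = false
isOdd (suc k) = not (isOdd k)

Sk : ∀ {σ n} → (π : ℕ → Sym σ → ℕ) → Vec (Fin σ) n → ℕ → List (Sym σ)
Sk π S zero    = map chr (Vec.toList S)
Sk π S (suc k) =
  if isOdd (suc k) then stepOdd (suc k) (Sk π S k)
                   else stepEven (suc k) (π (suc k)) (Sk π S k)

ValidOrder : ∀ {σ} → ℕ → (Sym σ → ℕ) → List (Sym σ) → Set
ValidOrder k π T =
  Σ ℕ λ d →
    (∀ A → A ∈ T → 1 ≤ π A × π A ≤ d) ×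
    (∀ A B → A ∈ T → B ∈ T → π A ≡ π B → A ≡ B) ×
    (∀ j → 1 ≤ j → j ≤ d → ∃ λ A → A ∈ T × π A ≡ j) ×
    (∀ A B → A ∈ T → B ∈ T → ¬ In𝒜 k A → In𝒜 k B → π A < π B)

-- m = ⌈log_{4/3}(4n)⌉ (for n ≥ 1): m is the least natural number with
-- 4n ≤ (4/3)^m, i.e. 4n·3^m ≤ 4^m.
IsCeilLog43 : ℕ → ℕ → Set
IsCeilLog43 x m = (x * 3 ^ m ≤ 4 ^ m) × (∀ j → j < m → 4 ^ j < x * 3 ^ j)

-- Odd steps never lengthen the sequence.  In an even step with threshold ℓ
-- every cut lies next to a symbol longer than ℓ (there are fewer than n/ℓ of
-- them, each touching two gaps) or at a local minimum among short symbols.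
-- Since long symbols come first in the order, a local minimum x is preceded
-- by a short symbol w with x < w, so the gap before x is uncut; hence the
-- local-minimum cuts use at most half of the remaining gaps, and
-- 2|S_k| ≤ |S_{k-1}| + 2·#long + 1.  As ℓ grows by 4/3 every second step,
-- induction gives |S_k| < 1 + 4n/ℓ_{k+1}, which at k = 2⌈log_{4/3} 4n⌉ is < 2.
module Submission where

open import Defs
open import Data.Nat using (ℕ; zero; suc; _+_; _*_; _^_; _≤_; _<_; z≤n; s≤s; _<?_; _≤?_; ⌊_/2⌋)
open import Data.Nat.Properties
open import Data.Nat.Tactic.RingSolver using (solve-∀)
open import Data.Bool using (Bool; true; false; not; _∧_; _∨_; if_then_else_)
open import Data.Bool.Properties using (∧-conicalˡ; ∧-conicalʳ; ∨-conicalʳ; ∧-zeroʳ; not-injective)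
open import Data.Fin using (Fin)
open import Data.Vec using (Vec)
import Data.Vec as Vec
import Data.Vec.Properties as Vec
open import Data.List using (List; []; _∷_; length; map; _++_; concat; replicate)
open import Data.List.Properties using (length-map; length-++; ++-assoc; ++-identityʳ)
open import Data.List.NonEmpty using (List⁺; _∷_; toList)
open import Data.List.Membership.Propositional using (_∈_)
open import Data.List.Relation.Unary.Any using (here; there)
open import Data.List.Relation.Unary.All as All using (All; []; _∷_)
open import Data.List.Relation.Unary.Linked using (Linked; [-]; _∷_)
open import Data.Maybe using (Maybe; just; nothing)
open import Data.Product using (_×_; _,_; ∃₂)
open import Data.Sum using (_⊎_; inj₁; inj₂)
open import Data.Unit using (⊤; tt)
open import Data.Empty using (⊥-elim)
open import Relation.Binary.PropositionalEquality using (_≡_; refl; sym; trans; cong; cong₂; subst)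
open import Relation.Nullary using (Dec; yes; no; ¬_)
open import Relation.Nullary.Decidable using (⌊_⌋)

⌊⌋-true⇒ : ∀ {P : Set} (d : Dec P) → ⌊ d ⌋ ≡ true → P
⌊⌋-true⇒ (yes p) _ = p

⌊⌋-false⇒¬ : ∀ {P : Set} (d : Dec P) → ⌊ d ⌋ ≡ false → ¬ P
⌊⌋-false⇒¬ (no ¬p) _ = ¬p

¬⇒⌊⌋-false : ∀ {P : Set} (d : Dec P) → ¬ P → ⌊ d ⌋ ≡ false
¬⇒⌊⌋-false (yes p) ¬p = ⊥-elim (¬p p)
¬⇒⌊⌋-false (no _)  _  = refl

bit : Bool → ℕ
bit false = 0
bit true  = 1

bit≤1 : ∀ b → bit b ≤ 1
bit≤1 false = z≤n
bit≤1 true  = s≤s z≤n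

#true : List Bool → ℕ
#true []       = 0
#true (b ∷ bs) = bit b + #true bs

#true≤length : ∀ bs → #true bs ≤ length bs
#true≤length []       = z≤n
#true≤length (b ∷ bs) = +-mono-≤ (bit≤1 b) (#true≤length bs)

module _ {A : Set} where

  splitB-head : ∀ (x : A) xs bs → ∃₂ λ r blocks → splitB (x ∷ xs) bs ≡ (x ∷ r) ∷ blocks
  splitB-head x []       bs           = [] , [] , refl
  splitB-head x (y ∷ ys) []           = [] , _ , refl
  splitB-head x (y ∷ ys) (true  ∷ bs) = [] , _ , refl
  splitB-head x (y ∷ ys) (false ∷ bs) with splitB-head y ys bs
  ... | r , blocks , split rewrite split = y ∷ r , blocks , refl

  length-splitB : ∀ (x : A) xs bs → length bs ≡ length xs →
                  length (splitB (x ∷ xs) bs) ≡ suc (#true bs)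
  length-splitB x []       []           _  = refl
  length-splitB x (y ∷ ys) (true  ∷ bs) eq = cong suc (length-splitB y ys bs (suc-injective eq))
  length-splitB x (y ∷ ys) (false ∷ bs) eq
    with splitB-head y ys bs | length-splitB y ys bs (suc-injective eq)
  ... | r , blocks , split | ih rewrite split = ih

  concat-consHead : ∀ (x : A) blocks →
                    concat (map toList (consHead x blocks)) ≡ x ∷ concat (map toList blocks)
  concat-consHead x []                  = refl
  concat-consHead x ((y ∷ ys) ∷ blocks) = refl

  concat-splitB : ∀ (xs : List A) bs → concat (map toList (splitB xs bs)) ≡ xs
  concat-splitB []           bs           = refl
  concat-splitB (x ∷ [])     bs           = refl
  concat-splitB (x ∷ y ∷ xs) []           = cong (x ∷_) (concat-splitB (y ∷ xs) [])
  concat-splitB (x ∷ y ∷ xs) (true  ∷ bs) = cong (x ∷_) (concat-splitB (y ∷ xs) bs)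
  concat-splitB (x ∷ y ∷ xs) (false ∷ bs) =
    trans (concat-consHead x (splitB (y ∷ xs) bs)) (cong (x ∷_) (concat-splitB (y ∷ xs) bs))

  UncutRelated : (A → A → Set) → List A → List Bool → Set
  UncutRelated R _            []       = ⊤
  UncutRelated R []           (_ ∷ _)  = ⊤
  UncutRelated R (_ ∷ [])     (_ ∷ _)  = ⊤
  UncutRelated R (x ∷ y ∷ xs) (b ∷ bs) = (b ≡ false → R x y) × UncutRelated R (y ∷ xs) bs

  splitB-linked : ∀ {R} (xs : List A) bs → UncutRelated R xs bs →
                  All (λ blk → Linked R (toList blk)) (splitB xs bs)
  splitB-linked []           bs           _         = []
  splitB-linked (x ∷ [])     bs           _         = [-] ∷ []
  splitB-linked (x ∷ y ∷ xs) []           _         = [-] ∷ splitB-linked (y ∷ xs) [] tt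
  splitB-linked (x ∷ y ∷ xs) (true  ∷ bs) (_ , rel) = [-] ∷ splitB-linked (y ∷ xs) bs rel
  splitB-linked (x ∷ y ∷ xs) (false ∷ bs) (Rxy , rel)
    with splitB-head y xs bs | splitB-linked (y ∷ xs) bs rel
  ... | r , blocks , split | linked rewrite split with linked
  ... | run ∷ runs = (Rxy refl ∷ run) ∷ runs

module _ {σ : ℕ} where

  expandList-++ : ∀ (As Bs : List (Sym σ)) → expandList (As ++ Bs) ≡ expandList As ++ expandList Bs
  expandList-++ []       Bs = refl
  expandList-++ (A ∷ As) Bs =
    trans (cong (expand A ++_) (expandList-++ As Bs)) (sym (++-assoc (expand A) _ _))

  expandList-map-splitB : (f : List⁺ (Sym σ) → Sym σ) (T : List (Sym σ)) (bs : List Bool) →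
    All (λ blk → expand (f blk) ≡ expandList (toList blk)) (splitB T bs) →
    expandList (map f (splitB T bs)) ≡ expandList T
  expandList-map-splitB f T bs faithful =
    trans (expandList-blocks faithful) (cong expandList (concat-splitB T bs))
    where
    expandList-blocks : ∀ {blocks} → All (λ blk → expand (f blk) ≡ expandList (toList blk)) blocks →
                        expandList (map f blocks) ≡ expandList (concat (map toList blocks))
    expandList-blocks []                   = refl
    expandList-blocks {blk ∷ _} (eq ∷ eqs) =
      trans (cong₂ _++_ eq (expandList-blocks eqs)) (sym (expandList-++ (toList blk) _))

  expand-blockSym : ∀ (blk : List⁺ (Sym σ)) → expand (blockSym blk) ≡ expandList (toList blk)
  expand-blockSym (x ∷ [])     = sym (++-identityʳ (expand x))
  expand-blockSym (x ∷ y ∷ xs) = refl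

  expandList-run : ∀ {x : Sym σ} {xs} → Linked _≡_ (x ∷ xs) →
                   expandList (x ∷ xs) ≡ concat (replicate (length (x ∷ xs)) (expand x))
  expandList-run     [-]          = refl
  expandList-run {x} (refl ∷ run) = cong (expand x ++_) (expandList-run run)

  expand-powSym : ∀ {blk} → Linked _≡_ (toList blk) → expand (powSym blk) ≡ expandList (toList blk)
  expand-powSym {x ∷ []}     _   = sym (++-identityʳ (expand x))
  expand-powSym {x ∷ y ∷ xs} run = sym (expandList-run run)

  boundOdd-uncut : ∀ k (T : List (Sym σ)) → UncutRelated _≡_ T (boundOdd k T)
  boundOdd-uncut k []           = tt
  boundOdd-uncut k (x ∷ [])     = tt
  boundOdd-uncut k (x ∷ y ∷ xs) =
    (λ uncut → ⌊⌋-true⇒ (x ≟S y) (not-injective (∨-conicalʳ (not (in𝒜? k y)) _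
      (∨-conicalʳ (not (in𝒜? k x)) _ uncut))))
    , boundOdd-uncut k (y ∷ xs)

  expandList-stepOdd : ∀ k (T : List (Sym σ)) → expandList (stepOdd k T) ≡ expandList T
  expandList-stepOdd k T = expandList-map-splitB powSym T (boundOdd k T)
    (All.map expand-powSym (splitB-linked T (boundOdd k T) (boundOdd-uncut k T)))

  expandList-stepEven : ∀ k π (T : List (Sym σ)) → expandList (stepEven k π T) ≡ expandList T
  expandList-stepEven k π T = expandList-map-splitB blockSym T (boundEven k π nothing T)
    (All.universal expand-blockSym _)

  #large : ℕ → List (Sym σ) → ℕ
  #large k T = #true (map (λ A → not (in𝒜? k A)) T)

  #large-bound : ∀ k T → #large k T * 4 ^ e k ≤ length (expandList T) * 3 ^ e k
  #large-bound k []       = z≤n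
  #large-bound k (A ∷ As) = begin
      (bit (not (in𝒜? k A)) + #large k As) * 4 ^ e k
    ≡⟨ *-distribʳ-+ (4 ^ e k) (bit (not (in𝒜? k A))) (#large k As) ⟩
      bit (not (in𝒜? k A)) * 4 ^ e k + #large k As * 4 ^ e k
    ≤⟨ +-mono-≤ (large-weight (length (expand A)) (4 ^ e k) (3 ^ e k)) (#large-bound k As) ⟩
      length (expand A) * 3 ^ e k + length (expandList As) * 3 ^ e k
    ≡⟨ *-distribʳ-+ (3 ^ e k) (length (expand A)) (length (expandList As)) ⟨
      (length (expand A) + length (expandList As)) * 3 ^ e k
    ≡⟨ cong (_* 3 ^ e k) (length-++ (expand A)) ⟨
      length (expandList (A ∷ As)) * 3 ^ e k
    ∎
    where
    open ≤-Reasoning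
    large-weight : ∀ m P Q → bit (not ⌊ m * Q ≤? P ⌋) * P ≤ m * Q
    large-weight m P Q with m * Q ≤? P
    ... | yes _     = z≤n
    ... | no  large = ≤-trans (≤-reflexive (+-identityʳ P)) (<⇒≤ (≰⇒> large))

  length-stepOdd : ∀ k (T : List (Sym σ)) → length (stepOdd k T) ≤ length T
  length-stepOdd k []       = z≤n
  length-stepOdd k (x ∷ xs) = begin
      length (map powSym (splitB (x ∷ xs) cuts))  ≡⟨ length-map powSym (splitB (x ∷ xs) cuts) ⟩
      length (splitB (x ∷ xs) cuts)               ≡⟨ length-splitB x xs cuts (length-cuts x xs) ⟩
      suc (#true cuts)                            ≤⟨ s≤s (#true≤length cuts) ⟩
      suc (length cuts)                           ≡⟨ cong suc (length-cuts x xs) ⟩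
      suc (length xs)                             ∎
    where
    open ≤-Reasoning
    cuts = boundOdd k (x ∷ xs)
    length-cuts : ∀ x xs → length (boundOdd k (x ∷ xs)) ≡ length xs
    length-cuts x []       = refl
    length-cuts x (y ∷ ys) = cong suc (length-cuts y ys)

-- The balance of one gap x|y: s = short, d = descends from its predecessor,
-- l = x is a local minimum.
cut-charge : ∀ sx sy l dx dy → (sx ≡ false → sy ≡ true → dy ≡ false) → (l ≡ true → dx ≡ true × dy ≡ false) →
  2 * bit (not sx ∨ not sy ∨ l) + bit (sy ∧ dy) ≤ suc (bit (not sx) + bit (sx ∧ dx) + bit (not sy))
cut-charge false true  l     dx dy large-first _ rewrite large-first refl refl = ≤-refl
cut-charge false false l     dx dy _ _ = s≤s (s≤s z≤n)
cut-charge true  false l     dx dy _ _ = s≤s (m≤n+m 1 (bit dx))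
cut-charge true  true  false dx dy _ _ = ≤-trans (bit≤1 dy) (s≤s z≤n)
cut-charge true  true  true  dx dy _ minimum with minimum refl
... | refl , refl = ≤-refl

add-charge : ∀ c cx cy bx by B Y N → 2 * c + cy ≤ suc (bx + cx + by) → 2 * B + by ≤ Y + 2 * N + cy →
             2 * (c + B) + bx ≤ suc Y + 2 * (bx + N) + cx
add-charge c cx cy bx by B Y N local rest = +-cancelʳ-≤ (by + cy) _ _ (begin
    2 * (c + B) + bx + (by + cy)                ≡⟨ regroup c cy B by bx ⟩
    (2 * c + cy) + (2 * B + by) + bx            ≤⟨ +-monoˡ-≤ bx (+-mono-≤ local rest) ⟩
    suc (bx + cx + by) + (Y + 2 * N + cy) + bx  ≡⟨ collect bx cx by Y N cy ⟩
    suc Y + 2 * (bx + N) + cx + (by + cy)       ∎)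
  where
  open ≤-Reasoning
  regroup : ∀ c cy B by bx → 2 * (c + B) + bx + (by + cy) ≡ (2 * c + cy) + (2 * B + by) + bx
  regroup = solve-∀
  collect : ∀ bx cx by Y N cy →
            suc (bx + cx + by) + (Y + 2 * N + cy) + bx ≡ suc Y + 2 * (bx + N) + cx + (by + cy)
  collect = solve-∀

module _ {σ : ℕ} (k : ℕ) (π : Sym σ → ℕ) where

  LargeBeforeSmall : List (Sym σ) → Set
  LargeBeforeSmall T = ∀ A B → A ∈ T → B ∈ T → ¬ In𝒜 k A → In𝒜 k B → π A < π B

  descent : Maybe (Sym σ) → Sym σ → Bool
  descent nothing  x = false
  descent (just w) x = ⌊ π x <? π w ⌋

  locMin⇒descents : ∀ p x y → locMin π p x y ≡ true → descent p x ≡ true × descent (just x) y ≡ false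
  locMin⇒descents (just w) x y minimum =
    ∧-conicalˡ _ _ minimum ,
    ¬⇒⌊⌋-false (π y <? π x) (<⇒≯ (⌊⌋-true⇒ (π x <? π y) (∧-conicalʳ _ _ minimum)))

  -- The last summand is a credit: if x is short and below its predecessor,
  -- the gap entering x is uncut and pays for a local-minimum cut right after x.
  cuts-bound : ∀ p x xs → LargeBeforeSmall (x ∷ xs) →
    2 * #true (boundEven k π p (x ∷ xs)) + bit (not (in𝒜? k x))
      ≤ length xs + 2 * #large k (x ∷ xs) + bit (in𝒜? k x ∧ descent p x)
  cuts-bound p x [] _ = lone (in𝒜? k x)
    where
    lone : ∀ s → bit (not s) ≤ 2 * (bit (not s) + 0) + bit (s ∧ descent p x)
    lone false = s≤s z≤n
    lone true  = z≤n
  cuts-bound p x (y ∷ ys) order =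
    add-charge (bit (not sx ∨ not sy ∨ locMin π p x y)) (bit (sx ∧ descent p x))
               (bit (sy ∧ descent (just x) y)) (bit (not sx)) (bit (not sy))
               (#true (boundEven k π (just x) (y ∷ ys))) (length ys) (#large k (y ∷ ys))
      (cut-charge sx sy (locMin π p x y) (descent p x) (descent (just x) y)
                  large-first (locMin⇒descents p x y))
      (cuts-bound (just x) y ys (λ A B A∈ B∈ → order A B (there A∈) (there B∈)))
    where
    sx = in𝒜? k x
    sy = in𝒜? k y
    large-first : sx ≡ false → sy ≡ true → descent (just x) y ≡ false
    large-first x-large y-small = ¬⇒⌊⌋-false (π y <? π x) (<⇒≯ (order x y (here refl) (there (here refl))
      (⌊⌋-false⇒¬ (_ ≤? _) x-large) (⌊⌋-true⇒ (_ ≤? _) y-small)))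

  length-stepEven : ∀ T → LargeBeforeSmall T → 2 * length (stepEven k π T) ≤ length T + 2 * #large k T + 1
  length-stepEven []       _     = z≤n
  length-stepEven (x ∷ xs) order = begin
      2 * length (map blockSym (splitB (x ∷ xs) cuts))
    ≡⟨ cong (2 *_) (trans (length-map blockSym (splitB (x ∷ xs) cuts))
                          (length-splitB x xs cuts (length-cuts nothing x xs))) ⟩
      2 * suc (#true cuts)
    ≡⟨ *-suc 2 (#true cuts) ⟩
      2 + 2 * #true cuts
    ≤⟨ +-monoʳ-≤ 2 first-cuts ⟩
      2 + (length xs + 2 * #large k (x ∷ xs))
    ≡⟨ shift (length xs) (#large k (x ∷ xs)) ⟩
      suc (length xs) + 2 * #large k (x ∷ xs) + 1
    ∎
    where
    open ≤-Reasoning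
    cuts = boundEven k π nothing (x ∷ xs)
    length-cuts : ∀ p x xs → length (boundEven k π p (x ∷ xs)) ≡ length xs
    length-cuts p x []       = refl
    length-cuts p x (y ∷ ys) = cong suc (length-cuts (just x) y ys)
    first-cuts : 2 * #true cuts ≤ length xs + 2 * #large k (x ∷ xs)
    first-cuts = begin
      2 * #true cuts                                     ≤⟨ m≤m+n _ _ ⟩
      2 * #true cuts + bit (not (in𝒜? k x))              ≤⟨ cuts-bound nothing x xs order ⟩
      length xs + 2 * #large k (x ∷ xs) + bit (in𝒜? k x ∧ false)
        ≡⟨ cong (λ b → length xs + 2 * #large k (x ∷ xs) + bit b) (∧-zeroʳ (in𝒜? k x)) ⟩
      length xs + 2 * #large k (x ∷ xs) + 0              ≡⟨ +-identityʳ _ ⟩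
      length xs + 2 * #large k (x ∷ xs)                  ∎
    shift : ∀ Y N → 2 + (Y + 2 * N) ≡ suc Y + 2 * N + 1
    shift = solve-∀

-- L < 1 + 4n / ℓ with ℓ = (4/3)^j, multiplied through by 4^j.
LengthBound : ℕ → ℕ → ℕ → Set
LengthBound n j L = L * 4 ^ j < 4 ^ j + 4 * n * 3 ^ j

LengthBound-base : ∀ n → LengthBound n 0 n
LengthBound-base n = s≤s (*-monoˡ-≤ 1 (m≤n*m n 4))

LengthBound-mono : ∀ n j {L L′} → L′ ≤ L → LengthBound n j L → LengthBound n j L′
LengthBound-mono n j L′≤L = ≤-<-trans (*-monoˡ-≤ (4 ^ j) L′≤L)

LengthBound-suc : ∀ n j L L′ N → LengthBound n j L → 2 * L′ ≤ L + 2 * N + 1 → N * 4 ^ j ≤ n * 3 ^ j →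
                  LengthBound n (suc j) L′
LengthBound-suc n j L L′ N bound halved large = begin
    suc (L′ * (4 * P))                       ≡⟨ cong suc (double L′ P) ⟩
    suc (2 * ((2 * L′) * P))                 ≤⟨ s≤s (*-monoʳ-≤ 2 (*-monoˡ-≤ P halved)) ⟩
    suc (2 * ((L + 2 * N + 1) * P))          ≤⟨ n≤1+n _ ⟩
    suc (suc (2 * ((L + 2 * N + 1) * P)))    ≡⟨ expand-out L N P ⟩
    2 * suc (L * P) + 4 * (N * P) + 2 * P    ≤⟨ +-monoˡ-≤ (2 * P) (+-mono-≤ (*-monoʳ-≤ 2 bound) (*-monoʳ-≤ 4 large)) ⟩
    2 * (P + 4 * n * Q) + 4 * (n * Q) + 2 * P ≡⟨ collect P Q n ⟩
    4 * P + 4 * n * (3 * Q)                  ∎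
  where
  open ≤-Reasoning
  P = 4 ^ j
  Q = 3 ^ j
  double : ∀ L′ P → L′ * (4 * P) ≡ 2 * ((2 * L′) * P)
  double = solve-∀
  expand-out : ∀ L N P → suc (suc (2 * ((L + 2 * N + 1) * P))) ≡ 2 * suc (L * P) + 4 * (N * P) + 2 * P
  expand-out = solve-∀
  collect : ∀ P Q n → 2 * (P + 4 * n * Q) + 4 * (n * Q) + 2 * P ≡ 4 * P + 4 * n * (3 * Q)
  collect = solve-∀

LengthBound⇒≤1 : ∀ n j L → 4 * n * 3 ^ j ≤ 4 ^ j → LengthBound n j L → L ≤ 1
LengthBound⇒≤1 n j L fits bound = ≤-pred (*-cancelʳ-< (4 ^ j) L 2 (begin-strict
    L * 4 ^ j                <⟨ bound ⟩
    4 ^ j + 4 * n * 3 ^ j    ≤⟨ +-monoʳ-≤ (4 ^ j) fits ⟩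
    4 ^ j + 4 ^ j            ≡⟨ cong (4 ^ j +_) (+-identityʳ (4 ^ j)) ⟨
    2 * 4 ^ j                ∎))
  where open ≤-Reasoning

e-step : ∀ k → (isOdd (suc k) ≡ true  × e (suc (suc k)) ≡ e (suc k))
             ⊎ (isOdd (suc k) ≡ false × e (suc (suc k)) ≡ suc (e (suc k)))
e-step zero    = inj₁ (refl , refl)
e-step (suc k) with e-step k
... | inj₁ (odd  , same) = inj₂ (cong not odd  , cong suc (sym same))
... | inj₂ (even , next) = inj₁ (cong not even , sym next)

e-odd-double : ∀ m → e (suc (2 * m)) ≡ m
e-odd-double m = trans (cong ⌊_/2⌋ (cong (m +_) (+-identityʳ m))) (sym (n≡⌊n+n/2⌋ m))

module _ {σ n : ℕ} (S : Vec (Fin σ) n) (π : ℕ → Sym σ → ℕ) where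

  expandList-Sk : ∀ k → expandList (Sk π S k) ≡ Vec.toList S
  expandList-Sk zero    = expandList-chr (Vec.toList S)
    where
    expandList-chr : ∀ as → expandList (map chr as) ≡ as
    expandList-chr []       = refl
    expandList-chr (a ∷ as) = cong (a ∷_) (expandList-chr as)
  expandList-Sk (suc k) = trans (expandList-step (isOdd (suc k))) (expandList-Sk k)
    where
    expandList-step : ∀ odd → expandList (if odd then stepOdd (suc k) (Sk π S k)
                                                 else stepEven (suc k) (π (suc k)) (Sk π S k))
                              ≡ expandList (Sk π S k)
    expandList-step true  = expandList-stepOdd (suc k) (Sk π S k)
    expandList-step false = expandList-stepEven (suc k) (π (suc k)) (Sk π S k)

  length-expandList-Sk : ∀ k → length (expandList (Sk π S k)) ≡ n
  length-expandList-Sk k = trans (cong length (expandList-Sk k)) (Vec.length-toList S)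

  Sk-nonempty : 1 ≤ n → ∀ k → 1 ≤ length (Sk π S k)
  Sk-nonempty 1≤n k = nonempty (Sk π S k) (subst (1 ≤_) (sym (length-expandList-Sk k)) 1≤n)
    where
    nonempty : ∀ T → 1 ≤ length (expandList T) → 1 ≤ length T
    nonempty (_ ∷ _) _ = s≤s z≤n

  length-Sk-bound : (∀ k → isOdd (suc k) ≡ false → ValidOrder (suc k) (π (suc k)) (Sk π S k)) →
                    ∀ k → LengthBound n (e (suc k)) (length (Sk π S k))
  length-Sk-bound valid zero    =
    subst (LengthBound n 0) (sym (trans (length-map chr (Vec.toList S)) (Vec.length-toList S)))
          (LengthBound-base n)
  length-Sk-bound valid (suc k) with e-step k
  ... | inj₁ (odd , same) = subst (λ j → LengthBound n j (length (Sk π S (suc k)))) (sym same)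
    (LengthBound-mono n (e (suc k)) shorter (length-Sk-bound valid k))
    where
    shorter : length (Sk π S (suc k)) ≤ length (Sk π S k)
    shorter rewrite odd = length-stepOdd (suc k) (Sk π S k)
  ... | inj₂ (even , next) = subst (λ j → LengthBound n j (length (Sk π S (suc k)))) (sym next)
    (LengthBound-suc n (e (suc k)) (length (Sk π S k)) (length (Sk π S (suc k))) (#large (suc k) (Sk π S k))
      (length-Sk-bound valid k) halved large)
    where
    halved : 2 * length (Sk π S (suc k)) ≤ length (Sk π S k) + 2 * #large (suc k) (Sk π S k) + 1
    halved with valid k even
    ... | _ , _ , _ , _ , order rewrite even = length-stepEven (suc k) (π (suc k)) (Sk π S k) order
    large : #large (suc k) (Sk π S k) * 4 ^ e (suc k) ≤ n * 3 ^ e (suc k)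
    large = subst (λ m → #large (suc k) (Sk π S k) * 4 ^ e (suc k) ≤ m * 3 ^ e (suc k))
                  (length-expandList-Sk k) (#large-bound (suc k) (Sk π S k))

corollary1 : (σ n : ℕ) (S : Vec (Fin σ) n) (π : ℕ → Sym σ → ℕ) →
    (∀ k → isOdd (suc k) ≡ false → ValidOrder (suc k) (π (suc k)) (Sk π S k)) →
    (∀ k → length (Sk π S k) * 4 ^ e (suc k) < 4 ^ e (suc k) + 4 * n * 3 ^ e (suc k))
    × (1 ≤ n → ∀ m → IsCeilLog43 (4 * n) m → length (Sk π S (2 * m)) ≡ 1)
corollary1 σ n S π valid = bound , singleton
  where
  bound : ∀ k → LengthBound n (e (suc k)) (length (Sk π S k))
  bound = length-Sk-bound S π valid
  singleton : 1 ≤ n → ∀ m → IsCeilLog43 (4 * n) m → length (Sk π S (2 * m)) ≡ 1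
  singleton 1≤n m (fits , _) = ≤-antisym
    (LengthBound⇒≤1 n m (length (Sk π S (2 * m))) fits (subst (λ j → LengthBound n j (length (Sk π S (2 * m)))) (e-odd-double m) (bound (2 * m))))
    (Sk-nonempty S π 1≤n (2 * m))
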